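{- Let $v$ be a non-empty word and let ${\tt x}$ be a letter smaller than or equal to the smallest character occurring in $v$. Then $r_{\$}(v)\le r_{\$}(v{\tt x})\le r_{\$}(v)+1$.
   Context: Words are over a finite totally ordered alphabet. $\$$ is an end-of-string symbol not in the alphabet and smaller than every letter. For a word $w$, $\mathrm{BWT}(w)$ is obtained by sorting the conjugates $w[i..n-1]w[0..i-1]$ of $w$ lexicographically and concatenating their last characters; $r_{\$}(w)$ is the number of maximal equal-letter runs of $\mathrm{BWT}(w\$)$. -}

module Defs where

open import Data.Nat using (ℕ; zero; suc; _+_)
open import Data.Nat.Properties using (≤-decTotalOrder; _≟_)
open import Data.Fin using (Fin; toℕ)
open import Data.List using (List; []; _∷_; _++_; [_]; map; drop; take; length; upTo)
open import Data.List.Relation.Binary.Lex.NonStrict using () renaming (≤-decTotalOrder to lex-decTotalOrder)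
open import Relation.Nullary using (yes; no)
open import Function using (_∘_)

import Data.List.Sort.InsertionSort as IS
open IS (lex-decTotalOrder ≤-decTotalOrder) using (sort) public

conj : List ℕ → ℕ → List ℕ
conj w i = drop i w ++ take i w

conjugates : List ℕ → List (List ℕ)
conjugates w = map (conj w) (upTo (length w))

-- last character (the default 0 is only used for the empty word, never
-- for a conjugate of a non-empty word)
lastChar : List ℕ → ℕ
lastChar []           = 0
lastChar (a ∷ [])     = a
lastChar (_ ∷ b ∷ l)  = lastChar (b ∷ l)

BWT : List ℕ → List ℕ
BWT w = map lastChar (sort (conjugates w))

runsFrom : ℕ → List ℕ → ℕ
runsFrom a []      = 1
runsFrom a (b ∷ l) with a ≟ b
... | yes _ = runsFrom b l
... | no  _ = suc (runsFrom b l)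

runs : List ℕ → ℕ
runs []      = 0
runs (a ∷ l) = runsFrom a l

-- Letter c is encoded as suc (toℕ c) and $ as 0, so $ is
-- smaller than every letter and the order on letters is preserved.
_$ : ∀ {σ} → List (Fin σ) → List ℕ
w $ = map (suc ∘ toℕ) w ++ [ 0 ]

r$ : ∀ {σ} → List (Fin σ) → ℕ
r$ w = runs (BWT (w $))

-- The conjugates of v x $ are $ v x, which is the smallest one and ends with x,
-- and, for every conjugate u of v $, the word obtained from u by inserting x just
-- before its $.  Because x is at most every letter of v, this insertion is
-- strictly monotone for the lexicographic order on conjugates of v $, and it
-- does not change last characters.  Hence BWT(v x $) = x · BWT(v $), and
-- prepending one letter to a word keeps or increases its number of runs by one.
module Submission where

open import Defs
open import Data.Nat using (ℕ; zero; suc; _≤_; _+_; _≟_; s≤s; z≤n)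
import Data.Nat.Properties as ℕ
open import Data.Fin using (Fin; toℕ)
open import Data.List using (List; []; _∷_; _++_; [_]; _∷ʳ_; map; drop; take; length; upTo)
import Data.List.Properties as List
open import Data.List.Relation.Unary.All as All using (All; []; _∷_)
open import Data.List.Relation.Unary.All.Properties using (map⁺; drop⁺; all-upTo)
open import Data.List.Relation.Binary.Lex.NonStrict using (base; halt; this; next)
  renaming (≤-decTotalOrder to lex-decTotalOrder)
open import Data.List.Relation.Binary.Pointwise using (Pointwise-≡⇒≡; ≡⇒Pointwise-≡)
open import Data.Product using (_×_; _,_)
open import Data.Sum using (inj₁; inj₂)
open import Data.Unit using (tt)
open import Function using (_∘_)
open import Level using (Level; 0ℓ)
open import Relation.Binary.Bundles using (DecTotalOrder)
open import Relation.Nullary using (yes; no; ¬_; contradiction)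
open import Relation.Unary using (Pred)
open import Relation.Binary.PropositionalEquality
  using (_≡_; _≢_; refl; sym; trans; cong; cong₂; subst; module ≡-Reasoning)

module _ {a ℓ₁ ℓ₂ : Level} (O : DecTotalOrder a ℓ₁ ℓ₂) where
  open DecTotalOrder O using (_≈_; total; antisym; reflexive)
    renaming (Carrier to A; _≤_ to _≼_; _≤?_ to _≼?_)
  open import Data.List.Sort.InsertionSort.Base O as IS using (insert)

  module _ {p : Level} {P : Pred A p} where

    All-insert : ∀ {x xs} → P x → All P xs → All P (insert x xs)
    All-insert {xs = []}     px []         = px ∷ []
    All-insert {x} {y ∷ ys} px (py ∷ pys) with x ≼? y
    ... | yes _ = px ∷ py ∷ pys
    ... | no  _ = py ∷ All-insert px pys

    All-sort : ∀ {xs} → All P xs → All P (IS.sort xs)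
    All-sort []         = []
    All-sort (px ∷ pxs) = All-insert px (All-sort pxs)

  module _ {p : Level} {P : Pred A p} {f : A → A}
           (f-mono : ∀ {x y} → P x → P y → x ≼ y → f x ≼ f y)
           (f-injective : ∀ {x y} → P x → P y → f x ≈ f y → x ≈ y) where

    f-reflects : ∀ {x y} → P x → P y → f x ≼ f y → x ≼ y
    f-reflects {x} {y} px py fx≤fy with total x y
    ... | inj₁ x≤y = x≤y
    ... | inj₂ y≤x = reflexive (f-injective px py (antisym fx≤fy (f-mono py px y≤x)))

    insert-map : ∀ {x ys} → P x → All P ys → insert (f x) (map f ys) ≡ map f (insert x ys)
    insert-map {ys = []}     px []         = refl
    insert-map {x} {y ∷ ys} px (py ∷ pys) with x ≼? y | f x ≼? f y
    ... | yes _   | yes _     = refl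
    ... | no  _   | no  _     = cong (f y ∷_) (insert-map px pys)
    ... | yes x≤y | no  fx≰fy = contradiction (f-mono px py x≤y) fx≰fy
    ... | no  x≰y | yes fx≤fy = contradiction (f-reflects px py fx≤fy) x≰y

    sort-map : ∀ {xs} → All P xs → IS.sort (map f xs) ≡ map f (IS.sort xs)
    sort-map []               = refl
    sort-map {x ∷ xs} (px ∷ pxs) =
      trans (cong (insert (f x)) (sort-map pxs)) (insert-map px (All-sort pxs))

  sort-∷ʳ-least : ∀ {x} xs → All (λ y → ¬ y ≼ x) xs → IS.sort (xs ∷ʳ x) ≡ x ∷ IS.sort xs
  sort-∷ʳ-least []       []           = refl
  sort-∷ʳ-least {x} (y ∷ ys) (y≰x ∷ ys≰x) rewrite sort-∷ʳ-least ys ys≰x with y ≼? x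
  ... | yes y≤x = contradiction y≤x y≰x
  ... | no  _   = refl

module _ {a : Level} {A : Set a} where

  length-∷ʳ : ∀ (u : List A) x → length (u ∷ʳ x) ≡ suc (length u)
  length-∷ʳ []      x = refl
  length-∷ʳ (_ ∷ u) x = cong suc (length-∷ʳ u x)

  drop-++ˡ : ∀ {n} (u v : List A) → n ≤ length u → drop n (u ++ v) ≡ drop n u ++ v
  drop-++ˡ {zero}  u       v _         = refl
  drop-++ˡ {suc n} (_ ∷ u) v (s≤s n≤) = drop-++ˡ u v n≤

  take-++ˡ : ∀ {n} (u v : List A) → n ≤ length u → take n (u ++ v) ≡ take n u
  take-++ˡ {zero}  u       v _         = refl
  take-++ˡ {suc n} (x ∷ u) v (s≤s n≤) = cong (x ∷_) (take-++ˡ u v n≤)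

conj-++ : ∀ {i} (u v : List ℕ) → i ≤ length u → conj (u ++ v) i ≡ drop i u ++ v ++ take i u
conj-++ {i} u v i≤ = begin
  drop i (u ++ v) ++ take i (u ++ v) ≡⟨ cong₂ _++_ (drop-++ˡ u v i≤) (take-++ˡ u v i≤) ⟩
  (drop i u ++ v) ++ take i u        ≡⟨ List.++-assoc (drop i u) v (take i u) ⟩
  drop i u ++ v ++ take i u          ∎
  where open ≡-Reasoning

conj-∷ʳ-length : ∀ (u : List ℕ) x → conj (u ∷ʳ x) (length u) ≡ x ∷ u
conj-∷ʳ-length u x =
  trans (conj-++ u [ x ] ℕ.≤-refl)
        (cong₂ (λ d t → d ++ x ∷ t) (List.drop-all _ u ℕ.≤-refl) (List.take-all _ u ℕ.≤-refl))

conjugates-∷ʳ : ∀ (u : List ℕ) x → conjugates (u ∷ʳ x) ≡ map (conj (u ∷ʳ x)) (upTo (suc (length u)))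
conjugates-∷ʳ u x = cong (map (conj (u ∷ʳ x)) ∘ upTo) (length-∷ʳ u x)

lastChar-∷ʳ : ∀ (u : List ℕ) x → lastChar (u ∷ʳ x) ≡ x
lastChar-∷ʳ []          x = refl
lastChar-∷ʳ (_ ∷ [])    x = refl
lastChar-∷ʳ (_ ∷ y ∷ u) x = lastChar-∷ʳ (y ∷ u) x

runs≤runs-∷ : ∀ x u → runs u ≤ runs (x ∷ u)
runs≤runs-∷ x []      = z≤n
runs≤runs-∷ x (y ∷ u) with x ≟ y
... | yes _ = ℕ.≤-refl
... | no  _ = ℕ.n≤1+n _

runs-∷≤runs+1 : ∀ x u → runs (x ∷ u) ≤ runs u + 1
runs-∷≤runs+1 x []      = s≤s z≤n
runs-∷≤runs+1 x (y ∷ u) with x ≟ y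
... | yes _ = ℕ.m≤m+n _ 1
... | no  _ = ℕ.≤-reflexive (ℕ.+-comm 1 _)

Lex : DecTotalOrder 0ℓ 0ℓ 0ℓ
Lex = lex-decTotalOrder ℕ.≤-decTotalOrder

open DecTotalOrder Lex using () renaming (_≤_ to _≼_; _≈_ to _≋_)

[]≼ : ∀ u → [] ≼ u
[]≼ []      = base tt
[]≼ (_ ∷ _) = halt

insertBefore$ : ℕ → List ℕ → List ℕ
insertBefore$ c []          = []
insertBefore$ c (zero ∷ u)  = c ∷ zero ∷ u
insertBefore$ c (suc a ∷ u) = suc a ∷ insertBefore$ c u

data _≤Before$_ (c : ℕ) : List ℕ → Set where
  $∷_ : ∀ u → c ≤Before$ (zero ∷ u)
  _∷_ : ∀ {a u} → c ≤ suc a → c ≤Before$ u → c ≤Before$ (suc a ∷ u)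

module _ {x : ℕ} where

  ≤Before$-++ : ∀ {u} v → All (suc x ≤_) u → suc x ≤Before$ (u ++ zero ∷ v)
  ≤Before$-++ v []                 = $∷ v
  ≤Before$-++ v (le@(s≤s _) ∷ les) = le ∷ ≤Before$-++ v les

  insertBefore$-++ : ∀ {u} v → All (suc x ≤_) u → insertBefore$ (suc x) (u ++ zero ∷ v) ≡ u ++ suc x ∷ zero ∷ v
  insertBefore$-++ v []                        = refl
  insertBefore$-++ {suc a ∷ _} v (s≤s _ ∷ les) = cong (suc a ∷_) (insertBefore$-++ v les)

  insertBefore$≢$∷ : ∀ u r → insertBefore$ (suc x) u ≢ zero ∷ r
  insertBefore$≢$∷ []          r ()
  insertBefore$≢$∷ (zero ∷ u)  r ()
  insertBefore$≢$∷ (suc a ∷ u) r ()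

  insertBefore$-injective : ∀ u v → insertBefore$ (suc x) u ≡ insertBefore$ (suc x) v → u ≡ v
  insertBefore$-injective []          []          _    = refl
  insertBefore$-injective []          (zero ∷ v)  ()
  insertBefore$-injective []          (suc b ∷ v) ()
  insertBefore$-injective (zero ∷ u)  []          ()
  insertBefore$-injective (suc a ∷ u) []          ()
  insertBefore$-injective (zero ∷ u)  (zero ∷ v)  refl = refl
  insertBefore$-injective (zero ∷ u)  (suc b ∷ v) eq   =
    contradiction (sym (List.∷-injectiveʳ eq)) (insertBefore$≢$∷ v u)
  insertBefore$-injective (suc a ∷ u) (zero ∷ v)  eq   =
    contradiction (List.∷-injectiveʳ eq) (insertBefore$≢$∷ u v)
  insertBefore$-injective (suc a ∷ u) (suc b ∷ v) eq   =
    cong₂ _∷_ (List.∷-injectiveˡ eq) (insertBefore$-injective u v (List.∷-injectiveʳ eq))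

  $∷≼insertBefore$ : ∀ {u} r → suc x ≤Before$ u → zero ∷ r ≼ insertBefore$ (suc x) u
  $∷≼insertBefore$ r ($∷ _)  = this (z≤n , λ ())
  $∷≼insertBefore$ r (_ ∷ _) = this (z≤n , λ ())

  insertBefore$≰$∷ : ∀ {u} r → suc x ≤Before$ u → ¬ insertBefore$ (suc x) u ≼ zero ∷ r
  insertBefore$≰$∷ r ($∷ _)  (this (() , _))
  insertBefore$≰$∷ r (_ ∷ _) (this (() , _))

  insertBefore$-mono : ∀ {u v} → suc x ≤Before$ v → u ≼ v → insertBefore$ (suc x) u ≼ insertBefore$ (suc x) v
  insertBefore$-mono _ (base tt) = base tt
  insertBefore$-mono {v = v} _ halt = []≼ (insertBefore$ (suc x) v)
  insertBefore$-mono {zero ∷ _}  ($∷ _) (this (_ , 0≢0)) = contradiction refl 0≢0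
  insertBefore$-mono {suc _ ∷ _} ($∷ _) (this (() , _))
  insertBefore$-mono {zero ∷ u} {suc b ∷ _} (x<b ∷ bv) (this _) with suc x ≟ suc b
  ... | yes refl = next refl ($∷≼insertBefore$ u bv)
  ... | no  x≢b  = this (x<b , x≢b)
  insertBefore$-mono {suc _ ∷ _} (_ ∷ _)  (this a<b)     = this a<b
  insertBefore$-mono ($∷ _)                (next refl u≼v) = next refl (next refl u≼v)
  insertBefore$-mono (_ ∷ bv)              (next refl u≼v) = next refl (insertBefore$-mono bv u≼v)

lastChar-∷-insertBefore$ : ∀ c a u → lastChar (a ∷ insertBefore$ c u) ≡ lastChar (a ∷ u)
lastChar-∷-insertBefore$ c a []          = refl
lastChar-∷-insertBefore$ c a (zero ∷ u)  = refl
lastChar-∷-insertBefore$ c a (suc b ∷ u) = lastChar-∷-insertBefore$ c (suc b) u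

lastChar-insertBefore$ : ∀ c u → lastChar (insertBefore$ c u) ≡ lastChar u
lastChar-insertBefore$ c []          = refl
lastChar-insertBefore$ c (zero ∷ u)  = refl
lastChar-insertBefore$ c (suc a ∷ u) = lastChar-∷-insertBefore$ c (suc a) u

module _ {x : ℕ} {t : List ℕ} (x<t : All (suc x ≤_) t) where
  open ≡-Reasoning

  private
    ψ : List ℕ → List ℕ
    ψ = insertBefore$ (suc x)

  conj-insertBefore$ : ∀ {i} → i ≤ length t →
                       conj (t ∷ʳ suc x ∷ʳ zero) i ≡ ψ (conj (t ∷ʳ zero) i)
  conj-insertBefore$ {i} i≤t = begin
    conj (t ∷ʳ suc x ∷ʳ zero) i         ≡⟨ cong (λ w → conj w i) (List.++-assoc t [ suc x ] [ zero ]) ⟩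
    conj (t ++ suc x ∷ zero ∷ []) i     ≡⟨ conj-++ t _ i≤t ⟩
    drop i t ++ suc x ∷ zero ∷ take i t ≡⟨ insertBefore$-++ (take i t) (drop⁺ i x<t) ⟨
    ψ (drop i t ++ zero ∷ take i t)     ≡⟨ cong ψ (conj-++ t [ zero ] i≤t) ⟨
    ψ (conj (t ∷ʳ zero) i)              ∎

  ≤Before$-conj : ∀ {i} → i ≤ length t → suc x ≤Before$ conj (t ∷ʳ zero) i
  ≤Before$-conj {i} i≤t =
    subst (suc x ≤Before$_) (sym (conj-++ t [ zero ] i≤t)) (≤Before$-++ (take i t) (drop⁺ i x<t))

  All-≤Before$-conjugates : All (suc x ≤Before$_) (conjugates (t ∷ʳ zero))
  All-≤Before$-conjugates = subst (All (suc x ≤Before$_)) (sym (conjugates-∷ʳ t zero))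
    (map⁺ (All.map (≤Before$-conj ∘ ℕ.m<1+n⇒m≤n) (all-upTo (suc (length t)))))

  conjugates-insertBefore$ :
    conjugates (t ∷ʳ suc x ∷ʳ zero) ≡ map ψ (conjugates (t ∷ʳ zero)) ∷ʳ (zero ∷ t ∷ʳ suc x)
  conjugates-insertBefore$ = begin
    conjugates (t′ ∷ʳ zero)                                     ≡⟨ conjugates-∷ʳ t′ zero ⟩
    map (conj (t′ ∷ʳ zero)) (upTo (suc (length t′)))            ≡⟨ cong (map (conj (t′ ∷ʳ zero))) (List.upTo-∷ʳ (length t′)) ⟨
    map (conj (t′ ∷ʳ zero)) (upTo (length t′) ∷ʳ length t′)     ≡⟨ List.map-++ _ (upTo (length t′)) _ ⟩
    map (conj (t′ ∷ʳ zero)) (upTo (length t′)) ∷ʳ conj (t′ ∷ʳ zero) (length t′)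
      ≡⟨ cong₂ _∷ʳ_ (cong (map (conj (t′ ∷ʳ zero)) ∘ upTo) (length-∷ʳ t (suc x))) (conj-∷ʳ-length t′ zero) ⟩
    map (conj (t′ ∷ʳ zero)) (upTo (suc (length t))) ∷ʳ (zero ∷ t′)
      ≡⟨ cong (_∷ʳ (zero ∷ t′)) (List.map-cong-local conj-insertBefore$-upTo) ⟩
    map (ψ ∘ conj (t ∷ʳ zero)) (upTo (suc (length t))) ∷ʳ (zero ∷ t′)
      ≡⟨ cong (_∷ʳ (zero ∷ t′)) (List.map-∘ (upTo (suc (length t)))) ⟩
    map ψ (map (conj (t ∷ʳ zero)) (upTo (suc (length t)))) ∷ʳ (zero ∷ t′)
      ≡⟨ cong (λ cs → map ψ cs ∷ʳ (zero ∷ t′)) (conjugates-∷ʳ t zero) ⟨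
    map ψ (conjugates (t ∷ʳ zero)) ∷ʳ (zero ∷ t′)               ∎
    where
    t′ : List ℕ
    t′ = t ∷ʳ suc x
    conj-insertBefore$-upTo : All (λ i → conj (t′ ∷ʳ zero) i ≡ ψ (conj (t ∷ʳ zero) i)) (upTo (suc (length t)))
    conj-insertBefore$-upTo = All.map (conj-insertBefore$ ∘ ℕ.m<1+n⇒m≤n) (all-upTo (suc (length t)))

  BWT-insertBefore$ : BWT (t ∷ʳ suc x ∷ʳ zero) ≡ suc x ∷ BWT (t ∷ʳ zero)
  BWT-insertBefore$ = begin
    map lastChar (sort (conjugates (t ∷ʳ suc x ∷ʳ zero)))
      ≡⟨ cong (map lastChar ∘ sort) conjugates-insertBefore$ ⟩
    map lastChar (sort (map ψ cs ∷ʳ (zero ∷ t ∷ʳ suc x)))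
      ≡⟨ cong (map lastChar) (sort-∷ʳ-least Lex (map ψ cs) ψcs≰$∷) ⟩
    lastChar (zero ∷ t ∷ʳ suc x) ∷ map lastChar (sort (map ψ cs))
      ≡⟨ cong₂ _∷_ (lastChar-∷ʳ (zero ∷ t) (suc x))
                   (cong (map lastChar) (sort-map Lex (λ _ → insertBefore$-mono) ψ-injective cs≥x)) ⟩
    suc x ∷ map lastChar (map ψ (sort cs))
      ≡⟨ cong (suc x ∷_) (List.map-∘ (sort cs)) ⟨
    suc x ∷ map (lastChar ∘ ψ) (sort cs)
      ≡⟨ cong (suc x ∷_) (List.map-cong (lastChar-insertBefore$ (suc x)) (sort cs)) ⟩
    suc x ∷ map lastChar (sort cs)                                ∎
    where
    cs : List (List ℕ)
    cs = conjugates (t ∷ʳ zero)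
    cs≥x : All (suc x ≤Before$_) cs
    cs≥x = All-≤Before$-conjugates
    ψcs≰$∷ : All (λ u → ¬ u ≼ zero ∷ t ∷ʳ suc x) (map ψ cs)
    ψcs≰$∷ = map⁺ (All.map (insertBefore$≰$∷ _) cs≥x)
    ψ-injective : ∀ {u v} → suc x ≤Before$ u → suc x ≤Before$ v → ψ u ≋ ψ v → u ≋ v
    ψ-injective {u} {v} _ _ = ≡⇒Pointwise-≡ ∘ insertBefore$-injective u v ∘ Pointwise-≡⇒≡

proposition10 : ∀ {σ : ℕ} (v : List (Fin σ)) (x : Fin σ) → v ≢ [] → All (λ c → x Data.Fin.≤ c) v → (r$ v Data.Nat.≤ r$ (v ++ [ x ])) × (r$ (v ++ [ x ]) Data.Nat.≤ r$ v + 1)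
proposition10 v x _ x≤v =
    ℕ.≤-trans (runs≤runs-∷ _ (BWT (v $))) (ℕ.≤-reflexive (sym r$-snoc))
  , ℕ.≤-trans (ℕ.≤-reflexive r$-snoc) (runs-∷≤runs+1 _ (BWT (v $)))
  where
  code : Fin _ → ℕ
  code = suc ∘ toℕ
  r$-snoc : r$ (v ++ [ x ]) ≡ runs (code x ∷ BWT (v $))
  r$-snoc = cong runs (trans (cong (BWT ∘ (_∷ʳ zero)) (List.map-++ code v [ x ]))
                             (BWT-insertBefore$ (map⁺ (All.map s≤s x≤v))))
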